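{- Let $i\in[m]$ and let $X\subseteq\{0,1\}^m$ be d-closed and $(i-1)$-balanced. Define $Y=\{u\in X: u_i=0,\ u+e_i\notin X\}$. Then $X\setminus Y$ is d-closed and $(i-1)$-balanced.
   Context: $e_i\in\{0,1\}^m$ is the word with a single $1$ in position $i$. For $u,v\in\{0,1\}^m$, write $v\prec u$ if $\mathrm{supp}(v)\subseteq\mathrm{supp}(u)$. A set $X\subseteq\{0,1\}^m$ is d-closed if $u\in X$ and $v\prec u$ imply $v\in X$. For $0\le k\le m$, $X$ is $k$-balanced if whenever $ab\in X$ with $a\in\{0,1\}^k$ (and $ab$ the concatenation), also $a'b\in X$ for all $a'\in\{0,1\}^k$; every set is $0$-balanced. -}

module Defs where

open import Data.Nat using (ℕ; _≤_)
open import Data.Bool using (Bool; true; false)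
open import Data.Fin using (Fin; toℕ)
open import Data.Vec using (Vec; lookup; _[_]≔_)
open import Data.Product using (_×_)
open import Relation.Nullary using (¬_)
open import Relation.Binary.PropositionalEquality using (_≡_)

-- Words of length m over {0,1}: false = 0, true = 1.
Word : ℕ → Set
Word m = Vec Bool m

WordSet : ℕ → Set₁
WordSet m = Word m → Set

_≺_ : ∀ {m} → Word m → Word m → Set
v ≺ u = ∀ j → lookup v j ≡ true → lookup u j ≡ true

DClosed : ∀ {m} → WordSet m → Set
DClosed X = ∀ u v → X u → v ≺ u → X v

-- k-balanced: if ab ∈ X with |a| = k, then a'b ∈ X for every a' of length k.
-- Equivalently (literal unfolding of concatenation): whenever u ∈ X and v
-- agrees with u on all positions with 0-based index ≥ k, then v ∈ X.
-- For k > m this says X is empty or everything; the statement only uses k ≤ m.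
Balanced : ∀ {m} → ℕ → WordSet m → Set
Balanced k X = ∀ u v → X u → (∀ j → k ≤ toℕ j → lookup v j ≡ lookup u j) → X v

-- u + e_i when u_i = 0: set position i to 1.
addE : ∀ {m} → Word m → Fin m → Word m
addE u i = u [ i ]≔ true

Yset : ∀ {m} → WordSet m → Fin m → WordSet m
Yset X i u = X u × (lookup u i ≡ false) × ¬ X (addE u i)

_∖_ : ∀ {m} → WordSet m → WordSet m → WordSet m
(X ∖ Y) u = X u × ¬ Y u

module Submission where

-- Both d-closedness and k-balancedness say that X is closed
-- under a relation on words: X u and R u v imply X v (for d-closedness
-- R u v is v ≺ u, for k-balancedness it is "v agrees with u from position k
-- on").  A set difference X ∖ Y is again R-closed as soon as X is R-closed
-- and membership in Y is reflected along R inside X, i.e. X u, R u v and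
-- Y v give Y u.  So the theorem reduces to checking this reflection property
-- for Y = Yset X i and the two relations:
--   * for ≺ we split on u_i: if u_i = 1 then v + e_i ≺ u lies in X, which is
--     impossible for v ∈ Y; if u_i = 0 then u + e_i ∈ X would force
--     v + e_i ∈ X, since adding e_i is monotone for ≺;
--   * for agreement from position i on, u_i = v_i, and adding e_i preserves
--     agreement, so u + e_i ∈ X would again force v + e_i ∈ X by balance.

open import Defs
open import Data.Nat using (ℕ; _≤_)
open import Data.Nat.Properties using (≤-refl)
open import Data.Fin using (Fin; toℕ; _≟_)
open import Data.Bool using (true; false)
open import Data.Product using (_×_; _,_)
open import Data.Vec using (lookup)
open import Data.Vec.Properties using (lookup∘update; lookup∘update′)
open import Data.Empty using (⊥-elim)
open import Relation.Nullary using (¬_; yes; no)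
open import Relation.Binary.PropositionalEquality using (_≡_; refl; sym; trans)

-- Closure of a set of words under a relation; DClosed and Balanced are
-- definitionally instances of it.
ClosedUnder : ∀ {m} → (Word m → Word m → Set) → WordSet m → Set
ClosedUnder R X = ∀ u v → X u → R u v → X v

AgreeFrom : ∀ {m} → ℕ → Word m → Word m → Set
AgreeFrom k u v = ∀ j → k ≤ toℕ j → lookup v j ≡ lookup u j

ReflectedIn : ∀ {m} → (Word m → Word m → Set) → WordSet m → WordSet m → Set
ReflectedIn R X Y = ∀ u v → X u → R u v → Y v → Y u

difference-closed : ∀ {m} {R : Word m → Word m → Set} {X Y : WordSet m} →
                    ClosedUnder R X → ReflectedIn R X Y → ClosedUnder R (X ∖ Y)
difference-closed closed reflected u v (xu , u∉Y) r =
  closed u v xu r , λ v∈Y → u∉Y (reflected u v xu r v∈Y)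

lookup-addE-other : ∀ {m} {i j : Fin m} (u : Word m) → ¬ j ≡ i →
                    lookup (addE u i) j ≡ lookup u j
lookup-addE-other u j≢i = lookup∘update′ j≢i u true

addE-monotone : ∀ {m} (i : Fin m) (u v : Word m) → v ≺ u → addE v i ≺ addE u i
addE-monotone i u v v≺u j vj with j ≟ i
... | yes refl = lookup∘update i u true
... | no j≢i   = trans (lookup-addE-other u j≢i)
                       (v≺u j (trans (sym (lookup-addE-other v j≢i)) vj))

addE-below : ∀ {m} (i : Fin m) (u v : Word m) →
             v ≺ u → lookup u i ≡ true → addE v i ≺ u
addE-below i u v v≺u ui j vj with j ≟ i
... | yes refl = ui
... | no j≢i   = v≺u j (trans (sym (lookup-addE-other v j≢i)) vj)

addE-agree : ∀ {m} (k : ℕ) (i : Fin m) (u v : Word m) →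
             AgreeFrom k u v → AgreeFrom k (addE u i) (addE v i)
addE-agree k i u v agree j kj with j ≟ i
... | yes refl = trans (lookup∘update i v true) (sym (lookup∘update i u true))
... | no j≢i   = trans (lookup-addE-other v j≢i)
                       (trans (agree j kj) (sym (lookup-addE-other u j≢i)))

Yset-reflects-≺ : ∀ {m} (i : Fin m) {X : WordSet m} → DClosed X →
                  ReflectedIn (λ u v → v ≺ u) X (Yset X i)
Yset-reflects-≺ i {X} closed u v xu v≺u (_ , _ , v+eᵢ∉X) with lookup u i in ui
... | true  = ⊥-elim (v+eᵢ∉X (closed u (addE v i) xu (addE-below i u v v≺u ui)))
... | false = xu , refl , λ u+eᵢ∈X →
                v+eᵢ∉X (closed (addE u i) (addE v i) u+eᵢ∈X (addE-monotone i u v v≺u))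

Yset-reflects-agree : ∀ {m} (i : Fin m) {X : WordSet m} → Balanced (toℕ i) X →
                      ReflectedIn (AgreeFrom (toℕ i)) X (Yset X i)
Yset-reflects-agree i balanced u v xu agree (_ , vᵢ≡0 , v+eᵢ∉X) =
  xu , trans (sym (agree i ≤-refl)) vᵢ≡0 , λ u+eᵢ∈X →
    v+eᵢ∉X (balanced (addE u i) (addE v i) u+eᵢ∈X (addE-agree (toℕ i) i u v agree))

lemma25 : (m : ℕ) (i : Fin m) (X : WordSet m) →
          DClosed X → Balanced (toℕ i) X →
          DClosed (X ∖ Yset X i) × Balanced (toℕ i) (X ∖ Yset X i)
lemma25 m i X closed balanced =
  difference-closed closed (Yset-reflects-≺ i closed) ,
  difference-closed balanced (Yset-reflects-agree i balanced)
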